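{- Let $p \in (0,\tfrac12]$ and let $f \in L^2(\{0,1\}^n,\mu_p)$. Suppose $f$ has $\beta$-small generalised influences, i.e. $\mathrm{I}_S(f) \le \beta\, \mathbb{E}_{\mu_p}[f^2]$ for all $S \subseteq [n]$. Then $\|\mathrm{T}_{1/5} f\|_4 \le \beta^{1/4}\|f\|_2$.
   Context: $\mu_p$ is the $p$-biased product measure on $\{0,1\}^n$ (each coordinate equals $1$ independently with probability $p$); all norms $\|\cdot\|_r$ are in $L^r(\{0,1\}^n,\mu_p)$. For $x \in \{0,1\}^n$ and $\rho\in[0,1]$, a sample $\mathbf{y}\sim N_\rho(x)$ is obtained by independently for each $i$ setting $\mathbf{y}_i = x_i$ with probability $\rho$ and otherwise resampling $\mathbf{y}_i$ with $\Pr[\mathbf{y}_i=1]=p$; the noise operator is $\mathrm{T}_\rho f(x) = \mathbb{E}_{\mathbf{y}\sim N_\rho(x)}[f(\mathbf{y})]$. For $S\subseteq[n]$ and $x\in\{0,1\}^S$, $f_{S\to x}$ is the function on $\{0,1\}^{[n]\setminus S}$ obtained by fixing the coordinates in $S$ according to $x$; $|x|$ is the number of ones in $x$. The generalised influence is $\mathrm{I}_S(f) = \mathbb{E}_{\mu_p}\big[\big(\sum_{x\in\{0,1\}^S}(-1)^{|S|-|x|} f_{S\to x}\big)^2\big]$.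
   Formalization: The parameter p and the constant β are rational, and f takes values in the rationals. -}

module Defs where

open import Data.Bool using (Bool; true; false; if_then_else_)
open import Data.Nat using (ℕ; zero; suc)
open import Data.Integer using (+_)
open import Data.Fin using (Fin)
open import Data.Vec using (Vec; []; _∷_; lookup; zipWith; foldr; tabulate; map; count)
open import Data.List using (List; []; _∷_; _++_) renaming (map to mapL; foldr to foldrL)
open import Data.Rational using (ℚ; 0ℚ; 1ℚ; _+_; _*_; _-_; -_; _/_)

-- Points of the cube {0,1}^n (true = 1). Subsets S ⊆ [n] are also Vec Bool n.
Cube : ℕ → Set
Cube n = Vec Bool n

allPts : (n : ℕ) → List (Cube n)
allPts zero = [] ∷ []
allPts (suc n) = mapL (false ∷_) (allPts n) ++ mapL (true ∷_) (allPts n)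

sumL : List ℚ → ℚ
sumL = foldrL _+_ 0ℚ

prodV : ∀ {n} → Vec ℚ n → ℚ
prodV = foldr _ _*_ 1ℚ

bitW : ℚ → Bool → ℚ
bitW p true = p
bitW p false = 1ℚ - p

μ : ℚ → ∀ {n} → Cube n → ℚ
μ p x = prodV (map (bitW p) x)

𝔼 : ℚ → ∀ {n} → (Cube n → ℚ) → ℚ
𝔼 p {n} f = sumL (mapL (λ x → μ p x * f x) (allPts n))

-- noise operator T_ρ: y_i = x_i w.p. ρ, else resampled ~ Bernoulli(p)
beq : Bool → Bool → Bool
beq true true = true
beq false false = true
beq _ _ = false

bitK : ℚ → ℚ → Bool → Bool → ℚ
bitK p ρ a b = (if beq a b then ρ else 0ℚ) + (1ℚ - ρ) * bitW p b

T : ℚ → ℚ → ∀ {n} → (Cube n → ℚ) → Cube n → ℚ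
T p ρ {n} f x = sumL (mapL (λ y → prodV (zipWith (bitK p ρ) x y) * f y) (allPts n))

replace : ∀ {n} → Vec Bool n → Cube n → Cube n → Cube n
replace S u z = zipWith (λ s uz → if s then Data.Product.proj₁ uz else Data.Product.proj₂ uz) S (zipWith Data.Product._,_ u z)
  where import Data.Product

-- u ⊆ S (u vanishes off S), so that u ranges over {0,1}^S
subsetB : ∀ {n} → Vec Bool n → Cube n → Bool
subsetB [] [] = true
subsetB (false ∷ S) (true ∷ u) = false
subsetB (_ ∷ S) (_ ∷ u) = subsetB S u

sgn : ℕ → ℚ
sgn zero = 1ℚ
sgn (suc k) = - sgn k

ones : ∀ {n} → Vec Bool n → ℕ
ones [] = 0
ones (true ∷ v) = suc (ones v)
ones (false ∷ v) = ones v

-- Σ_{x ∈ {0,1}^S} (-1)^{|S|-|x|} f_{S→x}, as a function on the whole cube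
-- (it does not depend on the coordinates in S)
derivS : ∀ {n} → Vec Bool n → (Cube n → ℚ) → Cube n → ℚ
derivS {n} S f z = sumL (mapL (λ u → if subsetB S u then sgn (ones S Data.Nat.∸ ones u) * f (replace S u z) else 0ℚ) (allPts n))

Inf : ℚ → ∀ {n} → Vec Bool n → (Cube n → ℚ) → ℚ
Inf p S f = 𝔼 p (λ z → derivS S f z * derivS S f z)

{-# OPTIONS --safe #-}
module Submission where

-- Induction on n, splitting off the first coordinate: f (b ∷ x) = g x + χ b * h x with g = avg₁ f, h = ∂₁ f
-- and χ b = b - p.  Then T_ρ f (b ∷ x) = T_ρ g x + ρ χ b T_ρ h x, while I_{0S} f = I_S g + σ I_S h and
-- I_{1S} f = I_S h, where σ = p (1 - p).  For ρ = 1/5 and p ≤ ½ an explicit sum-of-squares identity gives a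
-- two-point inequality bounding the average over b of (T_ρ f)² (T_ρ k)² by a fixed positive combination `mix`
-- of the four products built from the parts of f and of k.  The weights V S k are chosen so that
-- Ψ f k = Σ_S ω^|S| I_S f · V S k, with ω = 3σ, obeys the same recursion `mix`; hence
-- 𝔼 (T_ρ f)² (T_ρ k)² ≤ Ψ f k by induction.  Finally V S k ≥ 0 and Σ_S ω^|S| V S k = 𝔼 k², so small
-- influences I_S f ≤ β 𝔼 f² give Ψ f f ≤ β (𝔼 f²)².

open import Defs
open import Function using (_∘_)
open import Data.Bool using (Bool; true; false; if_then_else_)
open import Data.Integer using (+_)
open import Data.List using (List; []; _∷_; _++_) renaming (map to mapL)
import Data.List.Properties as List
open import Data.Nat using (ℕ; zero; suc; _∸_)
import Data.Nat as ℕ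
import Data.Nat.Properties as ℕₚ
open import Data.Rational using (ℚ; 0ℚ; 1ℚ; ½; _≤_; _<_; _+_; _-_; -_; _*_; _/_; NonNegative; nonNegative)
open import Data.Rational.Properties
  using (+-identityˡ; +-identityʳ; +-inverseʳ; +-assoc; *-identityˡ; *-zeroˡ; *-assoc; *-distribˡ-+;
         ≤-refl; ≤-reflexive; ≤-trans; <⇒≤; ≤-total; +-mono-≤; *-monoˡ-≤-nonNeg; *-monoʳ-≤-nonNeg;
         neg-antimono-≤; nonNegative⁻¹; nonNeg*nonNeg⇒nonNeg; module ≤-Reasoning)
open import Data.Rational.Solver using (module +-*-Solver)
open import Data.Sum using (inj₁; inj₂)
open import Data.Vec using (Vec; []; _∷_; zipWith)
open import Relation.Binary.PropositionalEquality
open +-*-Solver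

0≤+ : ∀ {x y} → 0ℚ ≤ x → 0ℚ ≤ y → 0ℚ ≤ x + y
0≤+ = +-mono-≤

0≤* : ∀ {x y} → 0ℚ ≤ x → 0ℚ ≤ y → 0ℚ ≤ x * y
0≤* {x} {y} 0≤x 0≤y = nonNegative⁻¹ (x * y) {{nonNeg*nonNeg⇒nonNeg x {{nonNegative 0≤x}} y {{nonNegative 0≤y}}}}

0≤x*x : ∀ x → 0ℚ ≤ x * x
0≤x*x x with ≤-total 0ℚ x
... | inj₁ 0≤x = 0≤* 0≤x 0≤x
... | inj₂ x≤0 = subst (0ℚ ≤_) (neg*neg x) (0≤* (neg-antimono-≤ x≤0) (neg-antimono-≤ x≤0))
  where
  neg*neg : ∀ x → (- x) * (- x) ≡ x * x
  neg*neg = solve 1 (λ x → (:- x) :* (:- x) := x :* x) refl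

*-monoˡ-≤ : ∀ {c a b} → 0ℚ ≤ c → a ≤ b → c * a ≤ c * b
*-monoˡ-≤ {c} 0≤c = *-monoˡ-≤-nonNeg c {{nonNegative 0≤c}}

p≤p+q : ∀ {p q} → 0ℚ ≤ q → p ≤ p + q
p≤p+q {p} 0≤q = subst (_≤ p + _) (+-identityʳ p) (+-mono-≤ (≤-refl {p}) 0≤q)

-- cubeSum α β F = Σₓ α^(n - |x|) β^|x| F x.  Expectation under μ_p is the case (1 - p, p);
-- summing over subsets S with weight ω^|S| is the case (1, ω).
cubeSum : ℚ → ℚ → ∀ {n} → (Cube n → ℚ) → ℚ
cubeSum α β {zero}  F = F []
cubeSum α β {suc n} F = α * cubeSum α β (F ∘ (false ∷_)) + β * cubeSum α β (F ∘ (true ∷_))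

sumL-++ : ∀ xs ys → sumL (xs ++ ys) ≡ sumL xs + sumL ys
sumL-++ []       ys = sym (+-identityˡ (sumL ys))
sumL-++ (x ∷ xs) ys = trans (cong (_+_ x) (sumL-++ xs ys)) (sym (+-assoc x (sumL xs) (sumL ys)))

sumL-allPts : ∀ {n} (F : Cube n → ℚ) → sumL (mapL F (allPts n)) ≡ cubeSum 1ℚ 1ℚ F
sumL-allPts {zero}  F = +-identityʳ (F [])
sumL-allPts {suc n} F = begin
    sumL (mapL F (mapL (false ∷_) ps ++ mapL (true ∷_) ps))
  ≡⟨ cong sumL (List.map-++ F (mapL (false ∷_) ps) (mapL (true ∷_) ps)) ⟩
    sumL (mapL F (mapL (false ∷_) ps) ++ mapL F (mapL (true ∷_) ps))
  ≡⟨ sumL-++ (mapL F (mapL (false ∷_) ps)) (mapL F (mapL (true ∷_) ps)) ⟩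
    sumL (mapL F (mapL (false ∷_) ps)) + sumL (mapL F (mapL (true ∷_) ps))
  ≡⟨ cong₂ _+_ (half false) (half true) ⟩
    1ℚ * cubeSum 1ℚ 1ℚ (F ∘ (false ∷_)) + 1ℚ * cubeSum 1ℚ 1ℚ (F ∘ (true ∷_))
  ∎
  where
  open ≡-Reasoning
  ps : List (Cube n)
  ps = allPts n
  half : ∀ b → sumL (mapL F (mapL (b ∷_) ps)) ≡ 1ℚ * cubeSum 1ℚ 1ℚ (F ∘ (b ∷_))
  half b = trans (cong sumL (sym (List.map-∘ ps))) (trans (sumL-allPts (F ∘ (b ∷_))) (sym (*-identityˡ _)))

record IsLinear {n} (L : (Cube n → ℚ) → ℚ) : Set where
  field
    cong-≗ : ∀ {F G} → F ≗ G → L F ≡ L G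
    +-homo : ∀ F G → L (λ x → F x + G x) ≡ L F + L G
    *-homo : ∀ c F → L (λ x → c * F x) ≡ c * L F

open IsLinear

module _ {n} {L : (Cube n → ℚ) → ℚ} (ℒ : IsLinear L) where

  linear-combination : ∀ a b F G → L (λ x → a * F x + b * G x) ≡ a * L F + b * L G
  linear-combination a b F G = trans (+-homo ℒ _ _) (cong₂ _+_ (*-homo ℒ a F) (*-homo ℒ b G))

  linear-zero : L (λ _ → 0ℚ) ≡ 0ℚ
  linear-zero = trans (*-homo ℒ 0ℚ (λ _ → 0ℚ)) (*-zeroˡ (L (λ _ → 0ℚ)))

isLinear-resp : ∀ {n} {L M : (Cube n → ℚ) → ℚ} → (∀ F → L F ≡ M F) → IsLinear L → IsLinear M
isLinear-resp L≡M ℒ = record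
  { cong-≗ = λ {F} {G} F≗G → trans (sym (L≡M F)) (trans (cong-≗ ℒ F≗G) (L≡M G))
  ; +-homo = λ F G → trans (sym (L≡M _)) (trans (+-homo ℒ F G) (cong₂ _+_ (L≡M F) (L≡M G)))
  ; *-homo = λ c F → trans (sym (L≡M _)) (trans (*-homo ℒ c F) (cong (c *_) (L≡M F)))
  }

isLinear-weighted : ∀ {m n} {L : (Cube m → ℚ) → ℚ} → IsLinear L →
                    (c : Cube m → ℚ) (φ : Cube m → Cube n) → IsLinear (λ F → L (λ y → c y * F (φ y)))
isLinear-weighted ℒ c φ = record
  { cong-≗ = λ F≗G → cong-≗ ℒ (λ y → cong (c y *_) (F≗G (φ y)))
  ; +-homo = λ F G → trans (cong-≗ ℒ (λ y → *-distribˡ-+ (c y) (F (φ y)) (G (φ y)))) (+-homo ℒ _ _)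
  ; *-homo = λ k F → trans (cong-≗ ℒ (λ y → swap (c y) k (F (φ y)))) (*-homo ℒ k _)
  }
  where
  swap : ∀ x k y → x * (k * y) ≡ k * (x * y)
  swap = solve 3 (λ x k y → x :* (k :* y) := k :* (x :* y)) refl

module _ {α β : ℚ} where

  cubeSum-cong : ∀ {n} {F G : Cube n → ℚ} → F ≗ G → cubeSum α β F ≡ cubeSum α β G
  cubeSum-cong {zero}  F≗G = F≗G []
  cubeSum-cong {suc n} F≗G =
    cong₂ (λ u v → α * u + β * v) (cubeSum-cong (F≗G ∘ (false ∷_))) (cubeSum-cong (F≗G ∘ (true ∷_)))

  cubeSum-+ : ∀ {n} (F G : Cube n → ℚ) → cubeSum α β (λ x → F x + G x) ≡ cubeSum α β F + cubeSum α β G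
  cubeSum-+ {zero}  F G = refl
  cubeSum-+ {suc n} F G =
    trans (cong₂ (λ u v → α * u + β * v) (cubeSum-+ (F ∘ (false ∷_)) (G ∘ (false ∷_)))
                                         (cubeSum-+ (F ∘ (true ∷_)) (G ∘ (true ∷_))))
          (interchange α β _ _ _ _)
    where
    interchange : ∀ α β a b c d → α * (a + b) + β * (c + d) ≡ (α * a + β * c) + (α * b + β * d)
    interchange = solve 6 (λ α β a b c d → α :* (a :+ b) :+ β :* (c :+ d) := (α :* a :+ β :* c) :+ (α :* b :+ β :* d)) refl

  cubeSum-* : ∀ {n} c (F : Cube n → ℚ) → cubeSum α β (λ x → c * F x) ≡ c * cubeSum α β F
  cubeSum-* {zero}  c F = refl
  cubeSum-* {suc n} c F =
    trans (cong₂ (λ u v → α * u + β * v) (cubeSum-* c (F ∘ (false ∷_))) (cubeSum-* c (F ∘ (true ∷_)))) (pull α β c _ _)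
    where
    pull : ∀ α β c a b → α * (c * a) + β * (c * b) ≡ c * (α * a + β * b)
    pull = solve 5 (λ α β c a b → α :* (c :* a) :+ β :* (c :* b) := c :* (α :* a :+ β :* b)) refl

  cubeSum-isLinear : ∀ {n} → IsLinear (cubeSum α β {n})
  cubeSum-isLinear = record { cong-≗ = cubeSum-cong ; +-homo = cubeSum-+ ; *-homo = cubeSum-* }

  cubeSum-mono : 0ℚ ≤ α → 0ℚ ≤ β → ∀ {n} {F G : Cube n → ℚ} → (∀ x → F x ≤ G x) →
                 cubeSum α β F ≤ cubeSum α β G
  cubeSum-mono 0≤α 0≤β {zero}  F≤G = F≤G []
  cubeSum-mono 0≤α 0≤β {suc n} F≤G =
    +-mono-≤ (*-monoˡ-≤ 0≤α (cubeSum-mono 0≤α 0≤β (F≤G ∘ (false ∷_))))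
             (*-monoˡ-≤ 0≤β (cubeSum-mono 0≤α 0≤β (F≤G ∘ (true ∷_))))

cubeSum-*ˡ : ∀ {α β n} c (P G : Cube n → ℚ) →
             cubeSum α β (λ y → (c * P y) * G y) ≡ c * cubeSum α β (λ y → P y * G y)
cubeSum-*ˡ c P G = trans (cubeSum-cong (λ y → *-assoc c (P y) (G y))) (cubeSum-* c (λ y → P y * G y))

𝔼≡cubeSum : ∀ p {n} (F : Cube n → ℚ) → 𝔼 p F ≡ cubeSum (1ℚ - p) p F
𝔼≡cubeSum p F = trans (sumL-allPts (λ x → μ p x * F x)) (μ-weights F)
  where
  μ-weights : ∀ {n} (F : Cube n → ℚ) → cubeSum 1ℚ 1ℚ (λ x → μ p x * F x) ≡ cubeSum (1ℚ - p) p F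
  μ-weights {zero}  F = *-identityˡ (F [])
  μ-weights {suc n} F = cong₂ _+_ (head false) (head true)
    where
    head : ∀ b → 1ℚ * cubeSum 1ℚ 1ℚ (λ y → (bitW p b * μ p y) * F (b ∷ y))
                 ≡ bitW p b * cubeSum (1ℚ - p) p (F ∘ (b ∷_))
    head b = trans (*-identityˡ _) (trans (cubeSum-*ˡ (bitW p b) (μ p) (F ∘ (b ∷_)))
                                          (cong (bitW p b *_) (μ-weights (F ∘ (b ∷_)))))

T-[] : ∀ p ρ (f : Cube 0 → ℚ) → T p ρ f [] ≡ f []
T-[] p ρ f = trans (sumL-allPts (λ y → prodV (zipWith (bitK p ρ) [] y) * f y)) (*-identityˡ (f []))

T-∷-kernel : ∀ p ρ {n} (f : Cube (suc n) → ℚ) b x →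
  T p ρ f (b ∷ x) ≡ bitK p ρ b false * T p ρ (f ∘ (false ∷_)) x + bitK p ρ b true * T p ρ (f ∘ (true ∷_)) x
T-∷-kernel p ρ {n} f b x =
  trans (sumL-allPts (λ y → prodV (zipWith (bitK p ρ) (b ∷ x) y) * f y)) (cong₂ _+_ (head false) (head true))
  where
  K : Cube n → ℚ
  K y = prodV (zipWith (bitK p ρ) x y)
  head : ∀ b′ → 1ℚ * cubeSum 1ℚ 1ℚ (λ y → (bitK p ρ b b′ * K y) * f (b′ ∷ y)) ≡ bitK p ρ b b′ * T p ρ (f ∘ (b′ ∷_)) x
  head b′ = trans (*-identityˡ _) (trans (cubeSum-*ˡ (bitK p ρ b b′) K (f ∘ (b′ ∷_)))
                                         (cong (bitK p ρ b b′ *_) (sym (sumL-allPts (λ y → K y * f (b′ ∷ y))))))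

T-isLinear : ∀ p ρ {n} (x : Cube n) → IsLinear (λ F → T p ρ F x)
T-isLinear p ρ x = isLinear-resp (λ F → sym (sumL-allPts (λ y → prodV (zipWith (bitK p ρ) x y) * F y)))
  (isLinear-weighted cubeSum-isLinear (λ y → prodV (zipWith (bitK p ρ) x y)) (λ y → y))

derivS-term : ∀ {n} → Vec Bool n → (Cube n → ℚ) → Cube n → Cube n → ℚ
derivS-term S f z u = if subsetB S u then sgn (ones S ∸ ones u) * f (replace S u z) else 0ℚ

derivS≡cubeSum : ∀ {n} (S : Vec Bool n) f z → derivS S f z ≡ cubeSum 1ℚ 1ℚ (derivS-term S f z)
derivS≡cubeSum S f z = sumL-allPts (derivS-term S f z)

derivS-isLinear : ∀ {n} (S : Vec Bool n) (z : Cube n) → IsLinear (λ F → derivS S F z)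
derivS-isLinear S z = isLinear-resp (λ F → trans (cubeSum-cong (λ u → if-* (subsetB S u))) (sym (derivS≡cubeSum S F z)))
  (isLinear-weighted cubeSum-isLinear (λ u → if subsetB S u then sgn (ones S ∸ ones u) else 0ℚ) (λ u → replace S u z))
  where
  if-* : ∀ b {s x} → (if b then s else 0ℚ) * x ≡ (if b then s * x else 0ℚ)
  if-* true  = refl
  if-* false {x = x} = *-zeroˡ x

derivS-[] : (f : Cube 0 → ℚ) → derivS [] f [] ≡ f []
derivS-[] f = trans (derivS≡cubeSum [] f []) (*-identityˡ (f []))

derivS-false : ∀ {n} (S : Vec Bool n) (f : Cube (suc n) → ℚ) b z → derivS (false ∷ S) f (b ∷ z) ≡ derivS S (f ∘ (b ∷_)) z
derivS-false {n} S f b z = begin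
    derivS (false ∷ S) f (b ∷ z)
  ≡⟨ derivS≡cubeSum (false ∷ S) f (b ∷ z) ⟩
    1ℚ * cubeSum 1ℚ 1ℚ (derivS-term S (f ∘ (b ∷_)) z) + 1ℚ * cubeSum 1ℚ 1ℚ {n} (λ _ → 0ℚ)
  ≡⟨ cong₂ _+_ (*-identityˡ (cubeSum 1ℚ 1ℚ (derivS-term S (f ∘ (b ∷_)) z)))
               (trans (*-identityˡ _) (linear-zero (cubeSum-isLinear {1ℚ} {1ℚ} {n}))) ⟩
    cubeSum 1ℚ 1ℚ (derivS-term S (f ∘ (b ∷_)) z) + 0ℚ
  ≡⟨ trans (+-identityʳ _) (sym (derivS≡cubeSum S (f ∘ (b ∷_)) z)) ⟩
    derivS S (f ∘ (b ∷_)) z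
  ∎
  where open ≡-Reasoning

ones-≤ : ∀ {n} (S u : Vec Bool n) → subsetB S u ≡ true → ones u ℕ.≤ ones S
ones-≤ []          []          _   = ℕ.z≤n
ones-≤ (false ∷ S) (true ∷ u)  ()
ones-≤ (false ∷ S) (false ∷ u) u⊆S = ones-≤ S u u⊆S
ones-≤ (true ∷ S)  (false ∷ u) u⊆S = ℕₚ.m≤n⇒m≤1+n (ones-≤ S u u⊆S)
ones-≤ (true ∷ S)  (true ∷ u)  u⊆S = ℕ.s≤s (ones-≤ S u u⊆S)

derivS-true : ∀ {n} (S : Vec Bool n) (f : Cube (suc n) → ℚ) b z →
  derivS (true ∷ S) f (b ∷ z) ≡ derivS S (f ∘ (true ∷_)) z - derivS S (f ∘ (false ∷_)) z
derivS-true {n} S f b z = begin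
    derivS (true ∷ S) f (b ∷ z)
  ≡⟨ derivS≡cubeSum (true ∷ S) f (b ∷ z) ⟩
    1ℚ * cubeSum 1ℚ 1ℚ (derivS-term (true ∷ S) f (b ∷ z) ∘ (false ∷_)) + 1ℚ * cubeSum 1ℚ 1ℚ D₁
  ≡⟨ cong (λ t → 1ℚ * t + 1ℚ * cubeSum 1ℚ 1ℚ D₁) (trans (cubeSum-cong sign-flip) (cubeSum-* (- 1ℚ) D₀)) ⟩
    1ℚ * (- 1ℚ * cubeSum 1ℚ 1ℚ D₀) + 1ℚ * cubeSum 1ℚ 1ℚ D₁
  ≡⟨ flip (cubeSum 1ℚ 1ℚ D₀) (cubeSum 1ℚ 1ℚ D₁) ⟩
    cubeSum 1ℚ 1ℚ D₁ - cubeSum 1ℚ 1ℚ D₀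
  ≡⟨ sym (cong₂ _-_ (derivS≡cubeSum S (f ∘ (true ∷_)) z) (derivS≡cubeSum S (f ∘ (false ∷_)) z)) ⟩
    derivS S (f ∘ (true ∷_)) z - derivS S (f ∘ (false ∷_)) z
  ∎
  where
  open ≡-Reasoning
  D₀ D₁ : Cube n → ℚ
  D₀ = derivS-term S (f ∘ (false ∷_)) z
  D₁ = derivS-term S (f ∘ (true ∷_)) z
  neg-* : ∀ s x → - s * x ≡ - 1ℚ * (s * x)
  neg-* = solve 2 (λ s x → :- s :* x := :- con 1ℚ :* (s :* x)) refl
  sign-flip : ∀ u → derivS-term (true ∷ S) f (b ∷ z) (false ∷ u) ≡ - 1ℚ * D₀ u
  sign-flip u with subsetB S u in u⊆S
  ... | false = refl
  ... | true rewrite ℕₚ.+-∸-assoc 1 (ones-≤ S u u⊆S) = neg-* (sgn (ones S ∸ ones u)) _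
  flip : ∀ a b → 1ℚ * (- 1ℚ * a) + 1ℚ * b ≡ b - a
  flip = solve 2 (λ a b → con 1ℚ :* (:- con 1ℚ :* a) :+ con 1ℚ :* b := b :- a) refl

module Decomposition (p : ℚ) where

  χ : Bool → ℚ
  χ false = - p
  χ true  = 1ℚ - p

  σ : ℚ
  σ = p * (1ℚ - p)

  avg₁ ∂₁ : ∀ {n} → (Cube (suc n) → ℚ) → Cube n → ℚ
  avg₁ f x = (1ℚ - p) * f (false ∷ x) + p * f (true ∷ x)
  ∂₁   f x = f (true ∷ x) - f (false ∷ x)

  𝔼² : ∀ {n} → (Cube n → ℚ) → ℚ
  𝔼² F = 𝔼 p (λ x → F x * F x)

  decompose : ∀ {n} (f : Cube (suc n) → ℚ) b → f ∘ (b ∷_) ≗ λ x → avg₁ f x + χ b * ∂₁ f x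
  decompose f false x = solve 3 (λ p f₀ f₁ → f₀ := ((con 1ℚ :- p) :* f₀ :+ p :* f₁) :+ (:- p) :* (f₁ :- f₀))
                                refl p (f (false ∷ x)) (f (true ∷ x))
  decompose f true  x = solve 3 (λ p f₀ f₁ → f₁ := ((con 1ℚ :- p) :* f₀ :+ p :* f₁) :+ (con 1ℚ :- p) :* (f₁ :- f₀))
                                refl p (f (false ∷ x)) (f (true ∷ x))

  module _ {n} {L : (Cube n → ℚ) → ℚ} (ℒ : IsLinear L) (f : Cube (suc n) → ℚ) where

    linear-∷ : ∀ b → L (f ∘ (b ∷_)) ≡ L (avg₁ f) + χ b * L (∂₁ f)
    linear-∷ b = trans (cong-≗ ℒ (decompose f b))
                       (trans (+-homo ℒ (avg₁ f) (λ x → χ b * ∂₁ f x))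
                              (cong (_+_ (L (avg₁ f))) (*-homo ℒ (χ b) (∂₁ f))))

    linear-∂₁ : L (f ∘ (true ∷_)) - L (f ∘ (false ∷_)) ≡ L (∂₁ f)
    linear-∂₁ = trans (cong₂ _-_ (linear-∷ true) (linear-∷ false)) (cancel p (L (avg₁ f)) (L (∂₁ f)))
      where
      cancel : ∀ p a d → (a + (1ℚ - p) * d) - (a + (- p) * d) ≡ d
      cancel = solve 3 (λ p a d → (a :+ (con 1ℚ :- p) :* d) :- (a :+ (:- p) :* d) := d) refl

  𝔼-isLinear : ∀ {n} → IsLinear (𝔼 p {n})
  𝔼-isLinear = isLinear-resp (λ F → sym (𝔼≡cubeSum p F)) cubeSum-isLinear

  𝔼-mono : 0ℚ ≤ p → 0ℚ ≤ 1ℚ - p → ∀ {n} {F G : Cube n → ℚ} → (∀ x → F x ≤ G x) → 𝔼 p F ≤ 𝔼 p G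
  𝔼-mono 0≤p 0≤1-p {F = F} {G} F≤G =
    subst₂ _≤_ (sym (𝔼≡cubeSum p F)) (sym (𝔼≡cubeSum p G)) (cubeSum-mono 0≤1-p 0≤p F≤G)

  𝔼-avg₁ : ∀ {n} (F : Cube (suc n) → ℚ) → 𝔼 p F ≡ 𝔼 p (avg₁ F)
  𝔼-avg₁ F = begin
      𝔼 p F
    ≡⟨ 𝔼≡cubeSum p F ⟩
      (1ℚ - p) * cubeSum (1ℚ - p) p (F ∘ (false ∷_)) + p * cubeSum (1ℚ - p) p (F ∘ (true ∷_))
    ≡⟨ cong₂ (λ u v → (1ℚ - p) * u + p * v) (𝔼≡cubeSum p (F ∘ (false ∷_))) (𝔼≡cubeSum p (F ∘ (true ∷_))) ⟨
      (1ℚ - p) * 𝔼 p (F ∘ (false ∷_)) + p * 𝔼 p (F ∘ (true ∷_))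
    ≡⟨ sym (linear-combination 𝔼-isLinear (1ℚ - p) p (F ∘ (false ∷_)) (F ∘ (true ∷_))) ⟩
      𝔼 p (avg₁ F)
    ∎
    where open ≡-Reasoning

  𝔼-∷-irrelevant : ∀ {n} {F : Cube (suc n) → ℚ} {G : Cube n → ℚ} →
                   (∀ b x → F (b ∷ x) ≡ G x) → 𝔼 p F ≡ 𝔼 p G
  𝔼-∷-irrelevant {F = F} {G} F≡G = trans (𝔼-avg₁ F) (cong-≗ 𝔼-isLinear (λ x →
    trans (cong₂ (λ u v → (1ℚ - p) * u + p * v) (F≡G false x) (F≡G true x)) (convex p (G x))))
    where
    convex : ∀ p g → (1ℚ - p) * g + p * g ≡ g
    convex = solve 2 (λ p g → (con 1ℚ :- p) :* g :+ p :* g := g) refl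

  𝔼²-cong : ∀ {n} {F G : Cube n → ℚ} → F ≗ G → 𝔼² F ≡ 𝔼² G
  𝔼²-cong F≗G = cong-≗ 𝔼-isLinear (λ x → cong₂ _*_ (F≗G x) (F≗G x))

  𝔼²-∷ : ∀ {n} (F : Cube (suc n) → ℚ) → 𝔼² F ≡ 𝔼² (avg₁ F) + σ * 𝔼² (∂₁ F)
  𝔼²-∷ F = begin
      𝔼² F
    ≡⟨ 𝔼-avg₁ (λ x → F x * F x) ⟩
      𝔼 p (avg₁ (λ x → F x * F x))
    ≡⟨ cong-≗ 𝔼-isLinear (λ x → pythagoras p (F (false ∷ x)) (F (true ∷ x))) ⟩
      𝔼 p (λ x → avg₁ F x * avg₁ F x + σ * (∂₁ F x * ∂₁ F x))
    ≡⟨ +-homo 𝔼-isLinear (λ x → avg₁ F x * avg₁ F x) (λ x → σ * (∂₁ F x * ∂₁ F x)) ⟩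
      𝔼² (avg₁ F) + 𝔼 p (λ x → σ * (∂₁ F x * ∂₁ F x))
    ≡⟨ cong (_+_ (𝔼² (avg₁ F))) (*-homo 𝔼-isLinear σ (λ x → ∂₁ F x * ∂₁ F x)) ⟩
      𝔼² (avg₁ F) + σ * 𝔼² (∂₁ F)
    ∎
    where
    open ≡-Reasoning
    pythagoras : ∀ p f₀ f₁ → (1ℚ - p) * (f₀ * f₀) + p * (f₁ * f₁)
      ≡ ((1ℚ - p) * f₀ + p * f₁) * ((1ℚ - p) * f₀ + p * f₁) + p * (1ℚ - p) * ((f₁ - f₀) * (f₁ - f₀))
    pythagoras = solve 3 (λ p f₀ f₁ → (con 1ℚ :- p) :* (f₀ :* f₀) :+ p :* (f₁ :* f₁)
      := ((con 1ℚ :- p) :* f₀ :+ p :* f₁) :* ((con 1ℚ :- p) :* f₀ :+ p :* f₁)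
         :+ p :* (con 1ℚ :- p) :* ((f₁ :- f₀) :* (f₁ :- f₀))) refl

  T-∷ : ∀ ρ {n} (f : Cube (suc n) → ℚ) b x → T p ρ f (b ∷ x) ≡ T p ρ (avg₁ f) x + ρ * χ b * T p ρ (∂₁ f) x
  T-∷ ρ f b x = begin
      T p ρ f (b ∷ x)
    ≡⟨ T-∷-kernel p ρ f b x ⟩
      bitK p ρ b false * T p ρ (f ∘ (false ∷_)) x + bitK p ρ b true * T p ρ (f ∘ (true ∷_)) x
    ≡⟨ cong₂ (λ u v → bitK p ρ b false * u + bitK p ρ b true * v) (linear-∷ ℒ f false) (linear-∷ ℒ f true) ⟩
      bitK p ρ b false * (A + χ false * B) + bitK p ρ b true * (A + χ true * B)
    ≡⟨ kernel-mean b ⟩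
      A + ρ * χ b * B
    ∎
    where
    open ≡-Reasoning
    ℒ : IsLinear (λ F → T p ρ F x)
    ℒ = T-isLinear p ρ x
    A B : ℚ
    A = T p ρ (avg₁ f) x
    B = T p ρ (∂₁ f) x
    kernel-mean : ∀ b → bitK p ρ b false * (A + χ false * B) + bitK p ρ b true * (A + χ true * B) ≡ A + ρ * χ b * B
    kernel-mean false = solve 4 (λ p ρ A B →
      (ρ :+ (con 1ℚ :- ρ) :* (con 1ℚ :- p)) :* (A :+ (:- p) :* B)
      :+ (con 0ℚ :+ (con 1ℚ :- ρ) :* p) :* (A :+ (con 1ℚ :- p) :* B)
        := A :+ ρ :* (:- p) :* B) refl p ρ A B
    kernel-mean true = solve 4 (λ p ρ A B →
      (con 0ℚ :+ (con 1ℚ :- ρ) :* (con 1ℚ :- p)) :* (A :+ (:- p) :* B)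
      :+ (ρ :+ (con 1ℚ :- ρ) :* p) :* (A :+ (con 1ℚ :- p) :* B)
        := A :+ ρ :* (con 1ℚ :- p) :* B) refl p ρ A B

  Inf-[] : (f : Cube 0 → ℚ) → Inf p [] f ≡ f [] * f []
  Inf-[] f = trans (𝔼≡cubeSum p (λ z → derivS [] f z * derivS [] f z)) (cong₂ _*_ (derivS-[] f) (derivS-[] f))

  Inf-false : ∀ {n} (S : Vec Bool n) (f : Cube (suc n) → ℚ) → Inf p (false ∷ S) f ≡ Inf p S (avg₁ f) + σ * Inf p S (∂₁ f)
  Inf-false {n} S f = trans (𝔼²-∷ D) (cong₂ (λ u v → u + σ * v) (𝔼²-cong avg₁-D) (𝔼²-cong ∂₁-D))
    where
    D : Cube (suc n) → ℚ
    D = derivS (false ∷ S) f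
    avg₁-D : avg₁ D ≗ derivS S (avg₁ f)
    avg₁-D y = trans (cong₂ (λ u v → (1ℚ - p) * u + p * v) (derivS-false S f false y) (derivS-false S f true y))
                     (sym (linear-combination (derivS-isLinear S y) (1ℚ - p) p (f ∘ (false ∷_)) (f ∘ (true ∷_))))
    ∂₁-D : ∂₁ D ≗ derivS S (∂₁ f)
    ∂₁-D y = trans (cong₂ _-_ (derivS-false S f true y) (derivS-false S f false y)) (linear-∂₁ (derivS-isLinear S y) f)

  Inf-true : ∀ {n} (S : Vec Bool n) (f : Cube (suc n) → ℚ) → Inf p (true ∷ S) f ≡ Inf p S (∂₁ f)
  Inf-true S f = 𝔼-∷-irrelevant (λ b y → cong₂ _*_ (D≡ b y) (D≡ b y))
    where
    D≡ : ∀ b y → derivS (true ∷ S) f (b ∷ y) ≡ derivS S (∂₁ f) y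
    D≡ b y = trans (derivS-true S f b y) (linear-∂₁ (derivS-isLinear S y) f)

¼ : ℚ
¼ = + 1 / 4

module FourthMoment (p : ℚ) where
  open Decomposition p

  ω : ℚ
  ω = + 3 / 1 * σ

  Σω : ∀ {n} → (Vec Bool n → ℚ) → ℚ
  Σω = cubeSum 1ℚ ω

  V : ∀ {n} → Vec Bool n → (Cube n → ℚ) → ℚ
  V []          k = k [] * k []
  V (false ∷ S) k = V S (avg₁ k) + σ * ¼ * V S (∂₁ k)
  V (true ∷ S)  k = ¼ * V S (∂₁ k)

  V-nonNeg : 0ℚ ≤ σ → ∀ {n} (S : Vec Bool n) k → 0ℚ ≤ V S k
  V-nonNeg 0≤σ []          k = 0≤x*x (k [])
  V-nonNeg 0≤σ (false ∷ S) k =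
    0≤+ (V-nonNeg 0≤σ S (avg₁ k)) (0≤* (0≤* 0≤σ (nonNegative⁻¹ ¼)) (V-nonNeg 0≤σ S (∂₁ k)))
  V-nonNeg 0≤σ (true ∷ S)  k = 0≤* (nonNegative⁻¹ ¼) (V-nonNeg 0≤σ S (∂₁ k))

  Σω-V : ∀ {n} (k : Cube n → ℚ) → Σω (λ S → V S k) ≡ 𝔼² k
  Σω-V {zero}  k = sym (𝔼≡cubeSum p (λ x → k x * k x))
  Σω-V {suc n} k = begin
      1ℚ * Σω (λ S → V S (avg₁ k) + σ * ¼ * V S (∂₁ k)) + ω * Σω (λ S → ¼ * V S (∂₁ k))
    ≡⟨ cong₂ (λ u v → 1ℚ * u + ω * v)
         (split (λ S → V S (avg₁ k)) (λ S → V S (∂₁ k)))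
         (*-homo cubeSum-isLinear ¼ (λ S → V S (∂₁ k))) ⟩
      1ℚ * (Σω (λ S → V S (avg₁ k)) + σ * ¼ * Σω (λ S → V S (∂₁ k))) + ω * (¼ * Σω (λ S → V S (∂₁ k)))
    ≡⟨ collect σ (Σω (λ S → V S (avg₁ k))) (Σω (λ S → V S (∂₁ k))) ⟩
      Σω (λ S → V S (avg₁ k)) + σ * Σω (λ S → V S (∂₁ k))
    ≡⟨ cong₂ (λ u v → u + σ * v) (Σω-V (avg₁ k)) (Σω-V (∂₁ k)) ⟩
      𝔼² (avg₁ k) + σ * 𝔼² (∂₁ k)
    ≡⟨ sym (𝔼²-∷ k) ⟩
      𝔼² k
    ∎
    where
    open ≡-Reasoning
    split : ∀ (G H : Vec Bool n → ℚ) → Σω (λ S → G S + σ * ¼ * H S) ≡ Σω G + σ * ¼ * Σω H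
    split G H = trans (+-homo cubeSum-isLinear G (λ S → σ * ¼ * H S)) (cong (_+_ (Σω G)) (*-homo cubeSum-isLinear (σ * ¼) H))
    collect : ∀ s a b → 1ℚ * (a + s * ¼ * b) + + 3 / 1 * s * (¼ * b) ≡ a + s * b
    collect = solve 3 (λ s a b → con 1ℚ :* (a :+ s :* con ¼ :* b) :+ con (+ 3 / 1) :* s :* (con ¼ :* b) := a :+ s :* b) refl

  Ψ : ∀ {n} → (Cube n → ℚ) → (Cube n → ℚ) → ℚ
  Ψ f k = Σω (λ S → Inf p S f * V S k)

  mix : ℚ → ℚ → ℚ → ℚ → ℚ
  mix A B C D = A + σ * ¼ * B + σ * C + (σ * σ + ω) * ¼ * D

  mix-linear : ∀ {n} {L : (Cube n → ℚ) → ℚ} → IsLinear L → ∀ A B C D →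
               L (λ x → mix (A x) (B x) (C x) (D x)) ≡ mix (L A) (L B) (L C) (L D)
  mix-linear {L = L} ℒ A B C D =
    trans (+-homo ℒ (λ x → A x + σ * ¼ * B x + σ * C x) (λ x → (σ * σ + ω) * ¼ * D x))
      (cong₂ _+_
        (trans (+-homo ℒ (λ x → A x + σ * ¼ * B x) (λ x → σ * C x))
          (cong₂ _+_ (trans (+-homo ℒ A (λ x → σ * ¼ * B x)) (cong (_+_ (L A)) (*-homo ℒ (σ * ¼) B)))
                     (*-homo ℒ σ C)))
        (*-homo ℒ ((σ * σ + ω) * ¼) D))

  mix-mono : 0ℚ ≤ σ → ∀ {A B C D A′ B′ C′ D′} → A ≤ A′ → B ≤ B′ → C ≤ C′ → D ≤ D′ →
             mix A B C D ≤ mix A′ B′ C′ D′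
  mix-mono 0≤σ A≤ B≤ C≤ D≤ =
    +-mono-≤ (+-mono-≤ (+-mono-≤ A≤ (*-monoˡ-≤ (0≤* 0≤σ 0≤¼) B≤)) (*-monoˡ-≤ 0≤σ C≤))
             (*-monoˡ-≤ (0≤* (0≤+ (0≤* 0≤σ 0≤σ) (0≤* (nonNegative⁻¹ (+ 3 / 1)) 0≤σ)) 0≤¼) D≤)
    where
    0≤¼ : 0ℚ ≤ ¼
    0≤¼ = nonNegative⁻¹ ¼

  Ψ-∷ : ∀ {n} (f k : Cube (suc n) → ℚ) →
        Ψ f k ≡ mix (Ψ (avg₁ f) (avg₁ k)) (Ψ (avg₁ f) (∂₁ k)) (Ψ (∂₁ f) (avg₁ k)) (Ψ (∂₁ f) (∂₁ k))
  Ψ-∷ {n} f k = begin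
      1ℚ * Σω (λ S → Inf p (false ∷ S) f * V (false ∷ S) k) + ω * Σω (λ S → Inf p (true ∷ S) f * V (true ∷ S) k)
    ≡⟨ linear-combination cubeSum-isLinear 1ℚ ω (λ S → Inf p (false ∷ S) f * V (false ∷ S) k)
                                                (λ S → Inf p (true ∷ S) f * V (true ∷ S) k) ⟨
      Σω (λ S → 1ℚ * (Inf p (false ∷ S) f * V (false ∷ S) k) + ω * (Inf p (true ∷ S) f * V (true ∷ S) k))
    ≡⟨ cubeSum-cong expand ⟩
      Σω (λ S → mix (I S f₀ * V S k₀) (I S f₀ * V S k₁) (I S f₁ * V S k₀) (I S f₁ * V S k₁))
    ≡⟨ mix-linear cubeSum-isLinear (λ S → I S f₀ * V S k₀) (λ S → I S f₀ * V S k₁)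
                                   (λ S → I S f₁ * V S k₀) (λ S → I S f₁ * V S k₁) ⟩
      mix (Ψ f₀ k₀) (Ψ f₀ k₁) (Ψ f₁ k₀) (Ψ f₁ k₁)
    ∎
    where
    open ≡-Reasoning
    I : Vec Bool n → (Cube n → ℚ) → ℚ
    I = Inf p
    f₀ f₁ k₀ k₁ : Cube n → ℚ
    f₀ = avg₁ f
    f₁ = ∂₁ f
    k₀ = avg₁ k
    k₁ = ∂₁ k
    tensor : ∀ s a b c d → 1ℚ * ((a + s * b) * (c + s * ¼ * d)) + + 3 / 1 * s * (b * (¼ * d))
                           ≡ a * c + s * ¼ * (a * d) + s * (b * c) + (s * s + + 3 / 1 * s) * ¼ * (b * d)
    tensor = solve 5 (λ s a b c d →
      con 1ℚ :* ((a :+ s :* b) :* (c :+ s :* con ¼ :* d)) :+ con (+ 3 / 1) :* s :* (b :* (con ¼ :* d))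
        := a :* c :+ s :* con ¼ :* (a :* d) :+ s :* (b :* c) :+ (s :* s :+ con (+ 3 / 1) :* s) :* con ¼ :* (b :* d)) refl
    expand : ∀ S → 1ℚ * (Inf p (false ∷ S) f * V (false ∷ S) k) + ω * (Inf p (true ∷ S) f * V (true ∷ S) k)
                   ≡ mix (I S f₀ * V S k₀) (I S f₀ * V S k₁) (I S f₁ * V S k₀) (I S f₁ * V S k₁)
    expand S = trans (cong₂ (λ u v → 1ℚ * (u * V (false ∷ S) k) + ω * (v * V (true ∷ S) k)) (Inf-false S f) (Inf-true S f))
                     (tensor σ (I S f₀) (I S f₁) (V S k₀) (V S k₁))

  Ψ-≤ : 0ℚ ≤ σ → ∀ {n} (f k : Cube n → ℚ) {M} → (∀ S → Inf p S f ≤ M) → Ψ f k ≤ M * 𝔼² k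
  Ψ-≤ 0≤σ f k {M} Inf≤M = begin
      Ψ f k
    ≤⟨ cubeSum-mono (nonNegative⁻¹ 1ℚ) 0≤ω
         (λ S → *-monoʳ-≤-nonNeg (V S k) {{nonNegative (V-nonNeg 0≤σ S k)}} (Inf≤M S)) ⟩
      Σω (λ S → M * V S k)
    ≡⟨ *-homo cubeSum-isLinear M (λ S → V S k) ⟩
      M * Σω (λ S → V S k)
    ≡⟨ cong (M *_) (Σω-V k) ⟩
      M * 𝔼² k
    ∎
    where
    open ≤-Reasoning
    0≤ω : 0ℚ ≤ ω
    0≤ω = 0≤* (nonNegative⁻¹ (+ 3 / 1)) 0≤σ


module Hypercontractive (p : ℚ) (0≤p : 0ℚ ≤ p) (p≤½ : p ≤ ½) where
  open Decomposition p
  open FourthMoment p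

  ρ₀ : ℚ
  ρ₀ = + 1 / 5

  Q : ℚ → ℚ → ℚ
  Q a c = a * a * (c * c)

  0≤1-2p : 0ℚ ≤ 1ℚ - p - p
  0≤1-2p = subst₂ _≤_ (+-inverseʳ (p + p)) (reassoc p) (+-mono-≤ (+-mono-≤ p≤½ p≤½) (≤-refl { - (p + p)}))
    where
    reassoc : ∀ p → ½ + ½ + - (p + p) ≡ 1ℚ - p - p
    reassoc = solve 1 (λ p → con ½ :+ con ½ :+ :- (p :+ p) := con 1ℚ :- p :- p) refl

  0≤1-p : 0ℚ ≤ 1ℚ - p
  0≤1-p = subst (0ℚ ≤_) (reassoc p) (0≤+ 0≤1-2p 0≤p)
    where
    reassoc : ∀ p → 1ℚ - p - p + p ≡ 1ℚ - p
    reassoc = solve 1 (λ p → con 1ℚ :- p :- p :+ p := con 1ℚ :- p) refl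

  0≤σ : 0ℚ ≤ σ
  0≤σ = 0≤* 0≤p 0≤1-p

  -- mix (Q a c) (Q a d) (Q b c) (Q b d) exceeds the average in `two-point` by exactly σ * certificate a b c d.
  certificate : ℚ → ℚ → ℚ → ℚ → ℚ
  certificate a b c d =
    (+ 61 / 500 + + 2 / 125 * p) * Q a d + (+ 109 / 125 + + 2 / 125 * p) * Q b c
    + (+ 1831 / 2500 + + 4 / 125 * p + σ * (+ 637 / 2500)) * Q b d
    + + 2 / 25 * ((a * d - b * c) * (a * d - b * c))
    + + 1 / 125 * (1ℚ - p - p) * ((a - b) * (a - b) * (d * d) + (c - d) * (c - d) * (b * b))

  certificate-nonNeg : ∀ a b c d → 0ℚ ≤ certificate a b c d
  certificate-nonNeg a b c d =
    0≤+ (0≤+ (0≤+ (0≤+ (0≤* (0≤+ (const _) (0≤* (const _) 0≤p)) (0≤Q a d))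
                       (0≤* (0≤+ (const _) (0≤* (const _) 0≤p)) (0≤Q b c)))
                  (0≤* (0≤+ (0≤+ (const _) (0≤* (const _) 0≤p)) (0≤* 0≤σ (const _))) (0≤Q b d)))
             (0≤* (const _) (0≤x*x (a * d - b * c))))
        (0≤* (0≤* (const _) 0≤1-2p) (0≤+ (0≤Q (a - b) d) (0≤Q (c - d) b)))
    where
    const : ∀ k {{_ : NonNegative k}} → 0ℚ ≤ k
    const k = nonNegative⁻¹ k
    0≤Q : ∀ a c → 0ℚ ≤ Q a c
    0≤Q a c = 0≤* (0≤x*x a) (0≤x*x c)

  two-point : ∀ a b c d →
    (1ℚ - p) * Q (a + ρ₀ * χ false * b) (c + ρ₀ * χ false * d) + p * Q (a + ρ₀ * χ true * b) (c + ρ₀ * χ true * d)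
      ≤ mix (Q a c) (Q a d) (Q b c) (Q b d)
  two-point a b c d = ≤-trans (p≤p+q (0≤* 0≤σ (certificate-nonNeg a b c d)))
    (≤-reflexive (solve 5 (λ p a b c d →
      let σ′ = p :* (con 1ℚ :- p)
          Q′ x y = x :* x :* (y :* y)
          ρ′ = con ρ₀
          certificate′ =
            (con (+ 61 / 500) :+ con (+ 2 / 125) :* p) :* Q′ a d :+ (con (+ 109 / 125) :+ con (+ 2 / 125) :* p) :* Q′ b c
            :+ (con (+ 1831 / 2500) :+ con (+ 4 / 125) :* p :+ σ′ :* con (+ 637 / 2500)) :* Q′ b d
            :+ con (+ 2 / 25) :* ((a :* d :- b :* c) :* (a :* d :- b :* c))
            :+ con (+ 1 / 125) :* (con 1ℚ :- p :- p) :* ((a :- b) :* (a :- b) :* (d :* d) :+ (c :- d) :* (c :- d) :* (b :* b))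
      in (con 1ℚ :- p) :* Q′ (a :+ ρ′ :* (:- p) :* b) (c :+ ρ′ :* (:- p) :* d)
           :+ p :* Q′ (a :+ ρ′ :* (con 1ℚ :- p) :* b) (c :+ ρ′ :* (con 1ℚ :- p) :* d) :+ σ′ :* certificate′
         := Q′ a c :+ σ′ :* con ¼ :* Q′ a d :+ σ′ :* Q′ b c :+ (σ′ :* σ′ :+ con (+ 3 / 1) :* σ′) :* con ¼ :* Q′ b d)
      refl p a b c d))

  fourth-moment-≤ : ∀ {n} (f k : Cube n → ℚ) → 𝔼 p (λ x → Q (T p ρ₀ f x) (T p ρ₀ k x)) ≤ Ψ f k
  fourth-moment-≤ {zero} f k = ≤-reflexive (begin
      𝔼 p (λ x → Q (T p ρ₀ f x) (T p ρ₀ k x))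
    ≡⟨ 𝔼≡cubeSum p (λ x → Q (T p ρ₀ f x) (T p ρ₀ k x)) ⟩
      Q (T p ρ₀ f []) (T p ρ₀ k [])
    ≡⟨ cong₂ Q (T-[] p ρ₀ f) (T-[] p ρ₀ k) ⟩
      f [] * f [] * (k [] * k [])
    ≡⟨ cong (_* (k [] * k [])) (sym (Inf-[] f)) ⟩
      Ψ f k
    ∎)
    where open ≡-Reasoning
  fourth-moment-≤ {suc n} f k = begin
      𝔼 p (λ x → Q (T p ρ₀ f x) (T p ρ₀ k x))
    ≡⟨ 𝔼-avg₁ (λ x → Q (T p ρ₀ f x) (T p ρ₀ k x)) ⟩
      𝔼 p (avg₁ (λ x → Q (T p ρ₀ f x) (T p ρ₀ k x)))
    ≤⟨ 𝔼-mono 0≤p 0≤1-p step ⟩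
      𝔼 p (λ x → mix (Q (A x) (C x)) (Q (A x) (D x)) (Q (B x) (C x)) (Q (B x) (D x)))
    ≡⟨ mix-linear 𝔼-isLinear (λ x → Q (A x) (C x)) (λ x → Q (A x) (D x)) (λ x → Q (B x) (C x)) (λ x → Q (B x) (D x)) ⟩
      mix (𝔼 p (λ x → Q (A x) (C x))) (𝔼 p (λ x → Q (A x) (D x)))
          (𝔼 p (λ x → Q (B x) (C x))) (𝔼 p (λ x → Q (B x) (D x)))
    ≤⟨ mix-mono 0≤σ (fourth-moment-≤ f₀ k₀) (fourth-moment-≤ f₀ k₁)
                    (fourth-moment-≤ f₁ k₀) (fourth-moment-≤ f₁ k₁) ⟩
      mix (Ψ f₀ k₀) (Ψ f₀ k₁) (Ψ f₁ k₀) (Ψ f₁ k₁)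
    ≡⟨ Ψ-∷ f k ⟨
      Ψ f k
    ∎
    where
    open ≤-Reasoning
    f₀ f₁ k₀ k₁ A B C D : Cube n → ℚ
    f₀ = avg₁ f
    f₁ = ∂₁ f
    k₀ = avg₁ k
    k₁ = ∂₁ k
    A = T p ρ₀ f₀
    B = T p ρ₀ f₁
    C = T p ρ₀ k₀
    D = T p ρ₀ k₁
    step : ∀ x → avg₁ (λ y → Q (T p ρ₀ f y) (T p ρ₀ k y)) x
                 ≤ mix (Q (A x) (C x)) (Q (A x) (D x)) (Q (B x) (C x)) (Q (B x) (D x))
    step x = ≤-trans
      (≤-reflexive (cong₂ (λ u v → (1ℚ - p) * u + p * v) (cong₂ Q (T-∷ ρ₀ f false x) (T-∷ ρ₀ k false x))
                                                         (cong₂ Q (T-∷ ρ₀ f true x) (T-∷ ρ₀ k true x))))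
      (two-point (A x) (B x) (C x) (D x))

theorem1p3 : (n : ℕ) (p β : ℚ) → 0ℚ < p → p ≤ ½ → 0ℚ ≤ β →
    (f : Cube n → ℚ) →
    ((S : Vec Bool n) → Inf p S f ≤ β * 𝔼 p (λ x → f x * f x)) →
    𝔼 p (λ x → T p (+ 1 / 5) f x * T p (+ 1 / 5) f x * (T p (+ 1 / 5) f x * T p (+ 1 / 5) f x))
      ≤ β * (𝔼 p (λ x → f x * f x) * 𝔼 p (λ x → f x * f x))
theorem1p3 n p β 0<p p≤½ _ f small = begin
    𝔼 p (λ x → Q (T p ρ₀ f x) (T p ρ₀ f x))
  ≤⟨ fourth-moment-≤ f f ⟩
    Ψ f f
  ≤⟨ Ψ-≤ 0≤σ f f small ⟩
    β * 𝔼² f * 𝔼² f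
  ≡⟨ *-assoc β (𝔼² f) (𝔼² f) ⟩
    β * (𝔼² f * 𝔼² f)
  ∎
  where
  open Decomposition p
  open FourthMoment p
  open Hypercontractive p (<⇒≤ 0<p) p≤½
  open ≤-Reasoning
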